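{- Let $G$ be a graph with $14$ vertices and $45$ edges, and let $u\in V(G)$ with $\deg_G(u)=7$. If $G$ is $3$-non-compliant, then $$\sum_{v\in N_G(u)}\deg_G(v)\ge 44.$$
   Context: All graphs are finite, simple and undirected; $\overline{G}$ denotes the complement of $G$; $N_G(u)$ is the set of vertices adjacent to $u$. A minor of $G$ is a graph obtained from $G$ by a sequence of vertex deletions, edge deletions and edge contractions. $\Delta(H)$ is the maximum degree of $H$. A graph $G$ on $n$ vertices is $3$-non-compliant if neither $G$ nor $\overline{G}$ has a minor $H$ with $\Delta(H)\ge n-3$. -}

module Defs where

open import Data.Nat using (ℕ; zero; suc; _+_; _*_; _∸_; _≥_; _<ᵇ_)
open import Data.Bool using (Bool; true; false; _∧_; _∨_; not; if_then_else_)
open import Data.Bool.Properties using (∨-comm)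
open import Data.Fin using (Fin; toℕ; punchIn)
open import Data.Fin.Properties using (_≟_)
open import Data.Product using (Σ; _×_; ∃-syntax)
open import Relation.Nullary using (¬_; yes; no)
open import Relation.Nullary.Decidable using (⌊_⌋)
open import Relation.Binary.PropositionalEquality using (_≡_; refl; sym; cong)

record Graph (n : ℕ) : Set where
  field
    adj    : Fin n → Fin n → Bool
    adj-sym    : ∀ i j → adj i j ≡ adj j i
    adj-irrefl : ∀ i → adj i i ≡ false
open Graph public

_==_ : ∀ {n} → Fin n → Fin n → Bool
i == j = ⌊ i ≟ j ⌋

==-sym : ∀ {n} (i j : Fin n) → (i == j) ≡ (j == i)
==-sym i j with i ≟ j | j ≟ i
... | yes _ | yes _ = refl
... | no _  | no _  = refl
... | yes p | no q  = Data.Empty.⊥-elim (q (sym p)) where import Data.Empty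
... | no p  | yes q = Data.Empty.⊥-elim (p (sym q)) where import Data.Empty

==-refl : ∀ {n} (i : Fin n) → (i == i) ≡ true
==-refl i with i ≟ i
... | yes _ = refl
... | no ¬p = Data.Empty.⊥-elim (¬p refl) where import Data.Empty

symmetrize : ∀ {n} → (Fin n → Fin n → Bool) → Graph n
symmetrize r = record
  { adj = λ i j → not (i == j) ∧ (r i j ∨ r j i)
  ; adj-sym = λ i j → Relation.Binary.PropositionalEquality.cong₂ (λ a b → not a ∧ b) (==-sym i j) (∨-comm (r i j) (r j i))
  ; adj-irrefl = λ i → cong (λ a → not a ∧ (r i i ∨ r i i)) (==-refl i)
  }

sumFin : ∀ {n} → (Fin n → ℕ) → ℕ
sumFin {zero}  f = 0
sumFin {suc n} f = f Fin.zero + sumFin (λ i → f (Fin.suc i))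
  where import Data.Fin as Fin

ind : Bool → ℕ
ind true  = 1
ind false = 0

degree : ∀ {n} → Graph n → Fin n → ℕ
degree G u = sumFin (λ v → ind (adj G u v))

edgeCount : ∀ {n} → Graph n → ℕ
edgeCount G = sumFin (λ i → sumFin (λ j → ind ((toℕ i <ᵇ toℕ j) ∧ adj G i j)))

neighbourDegreeSum : ∀ {n} → Graph n → Fin n → ℕ
neighbourDegreeSum G u = sumFin (λ v → if adj G u v then degree G v else 0)

complement : ∀ {n} → Graph n → Graph n
complement G = symmetrize (λ i j → not (adj G i j))

deleteVertex : ∀ {n} → Graph (suc n) → Fin (suc n) → Graph n
deleteVertex G v = symmetrize (λ x y → adj G (punchIn v x) (punchIn v y))

deleteEdge : ∀ {n} → Graph n → Fin n → Fin n → Graph n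
deleteEdge G a b = symmetrize (λ x y → adj G x y ∧ not ((x == a ∧ y == b) ∨ (x == b ∧ y == a)))

-- contract the edge {punchIn v u , v}: v is merged into u = punchIn v u
-- (the merged vertex keeps index u; the edge must be present)
contract : ∀ {n} → Graph (suc n) → Fin (suc n) → Fin n → Graph n
contract G v u = symmetrize (λ x y → adj G (punchIn v x) (punchIn v y) ∨ (x == u ∧ adj G v (punchIn v y)))

data _≼_ : ∀ {m n} → Graph m → Graph n → Set where
  ≼-refl   : ∀ {n} {G : Graph n} → G ≼ G
  ≼-delV   : ∀ {m n} {H : Graph m} {G : Graph (suc n)} (v : Fin (suc n)) →
             H ≼ deleteVertex G v → H ≼ G
  ≼-delE   : ∀ {m n} {H : Graph m} {G : Graph n} (a b : Fin n) → adj G a b ≡ true →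
             H ≼ deleteEdge G a b → H ≼ G
  ≼-contr  : ∀ {m n} {H : Graph m} {G : Graph (suc n)} (v : Fin (suc n)) (u : Fin n) →
             adj G (punchIn v u) v ≡ true → H ≼ contract G v u → H ≼ G

MaxDegreeAtLeast : ∀ {m} → Graph m → ℕ → Set
MaxDegreeAtLeast H k = ∃[ x ] degree H x ≥ k

HasMinorWithMaxDegree≥ : ∀ {n} → Graph n → ℕ → Set
HasMinorWithMaxDegree≥ G k = Σ ℕ λ m → Σ (Graph m) λ H → H ≼ G × MaxDegreeAtLeast H k

NonCompliant3 : ∀ {n} → Graph n → Set
NonCompliant3 {n} G = ¬ HasMinorWithMaxDegree≥ G (n ∸ 3) × ¬ HasMinorWithMaxDegree≥ (complement G) (n ∸ 3)

module Submission where

-- Write A for the six vertices other than u that are not adjacent to u. The degrees of G sum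
-- to 90, so Σ_{v ∈ N(u)} deg v = 83 − Σ_{a ∈ A} deg a, and by double counting
-- Σ_{a ∈ A} deg a = Σ_{v ≠ u} |N(v) ∩ A|. Each term of the last sum is at most 3. If x–y–z is a
-- path of G and every other vertex is adjacent to one of x, y, z, contracting the path gives a
-- 12-vertex minor with a vertex of degree 11; so in a 3-non-compliant graph every path has a
-- common non-neighbour, and dually every path of the complement has a common neighbour.
-- Alternating these two facts through u yields, for each v ≠ u, three vertices of A that are
-- not adjacent to v.

open import Defs
open import Data.Nat using (ℕ; zero; suc; _+_; _≤_; _≥_; _<ᵇ_; z≤n; s≤s)
open import Data.Nat.Properties
  using ( +-0-commutativeMonoid; +-identityʳ; +-mono-≤; +-monoˡ-≤; +-monoʳ-≤; +-cancelˡ-≡; +-cancelˡ-≤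
        ; +-cancelʳ-≤; suc-injective; ≤-refl; ≤-trans; ≤-reflexive; module ≤-Reasoning)
open import Data.Bool using (Bool; true; false; _∧_; _∨_; not; if_then_else_)
open import Data.Bool.Properties
  using (∧-comm; ∧-zeroʳ; ∧-identityʳ; ∧-conicalˡ; ∧-conicalʳ; ∨-zeroʳ; ∨-idem; not-injective; ¬-not)
  renaming (_≟_ to _≟ᵇ_)
open import Data.Fin using (Fin; zero; suc; toℕ; punchIn; punchOut)
open import Data.Fin.Properties
  using (_≟_; toℕ-injective; punchIn-injective; punchInᵢ≢i; punchIn-punchOut; punchOut-injective; ¬∀⟶∃¬)
open import Data.Product using (∃; _×_; _,_; proj₁; proj₂)
open import Data.Sum using (_⊎_; inj₁; inj₂)
open import Function using (_∘_)
open import Relation.Nullary using (¬_; contradiction)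
open import Relation.Nullary.Decidable using (isYes≗does; dec-false; _⊎-dec_)
open import Relation.Unary using (Decidable)
open import Relation.Binary.PropositionalEquality
  using (_≡_; _≢_; refl; sym; trans; cong; cong₂; subst; module ≡-Reasoning)
open import Algebra.Properties.CommutativeMonoid.Sum +-0-commutativeMonoid
  using (sum; sum-cong-≗; sum-replicate-zero; sum-remove; ∑-distrib-+; ∑-comm)

sumFin≡sum : ∀ {n} (f : Fin n → ℕ) → sumFin f ≡ sum f
sumFin≡sum {zero}  f = refl
sumFin≡sum {suc n} f = cong (f zero +_) (sumFin≡sum (f ∘ suc))

sumFin-cong : ∀ {n} {f g : Fin n → ℕ} → (∀ i → f i ≡ g i) → sumFin f ≡ sumFin g
sumFin-cong {f = f} {g} f≗g =
  trans (sumFin≡sum f) (trans (sum-cong-≗ f≗g) (sym (sumFin≡sum g)))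

sumFin-mono : ∀ {n} {f g : Fin n → ℕ} → (∀ i → f i ≤ g i) → sumFin f ≤ sumFin g
sumFin-mono {zero}  f≤g = z≤n
sumFin-mono {suc n} f≤g = +-mono-≤ (f≤g zero) (sumFin-mono (f≤g ∘ suc))

sumFin-zero : ∀ n → sumFin {n} (λ _ → 0) ≡ 0
sumFin-zero n = trans (sumFin≡sum {n} (λ _ → 0)) (sum-replicate-zero n)

sumFin-+ : ∀ {n} (f g : Fin n → ℕ) → sumFin (λ i → f i + g i) ≡ sumFin f + sumFin g
sumFin-+ f g = begin
  sumFin (λ i → f i + g i)  ≡⟨ sumFin≡sum (λ i → f i + g i) ⟩
  sum (λ i → f i + g i)     ≡⟨ ∑-distrib-+ f g ⟩
  sum f + sum g             ≡⟨ cong₂ _+_ (sumFin≡sum f) (sumFin≡sum g) ⟨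
  sumFin f + sumFin g       ∎
  where open ≡-Reasoning

sumFin-comm : ∀ {m n} (f : Fin m → Fin n → ℕ) →
              sumFin (λ i → sumFin (f i)) ≡ sumFin (λ j → sumFin (λ i → f i j))
sumFin-comm f = begin
  sumFin (λ i → sumFin (f i))          ≡⟨ double f ⟩
  sum (λ i → sum (f i))                ≡⟨ ∑-comm f ⟩
  sum (λ j → sum (λ i → f i j))        ≡⟨ double (λ j i → f i j) ⟨
  sumFin (λ j → sumFin (λ i → f i j))  ∎
  where
  open ≡-Reasoning
  double : ∀ {m n} (g : Fin m → Fin n → ℕ) → sumFin (λ i → sumFin (g i)) ≡ sum (λ i → sum (g i))
  double g = trans (sumFin-cong (sumFin≡sum ∘ g)) (sumFin≡sum (λ i → sum (g i)))

sumFin-remove : ∀ {n} (f : Fin (suc n) → ℕ) i → sumFin f ≡ f i + sumFin (f ∘ punchIn i)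
sumFin-remove f i =
  trans (sumFin≡sum f) (trans (sum-remove {i = i} f) (cong (f i +_) (sym (sumFin≡sum (f ∘ punchIn i)))))

sumFin-split : ∀ {n} (p : Fin n → Bool) (f : Fin n → ℕ) →
               sumFin f ≡ sumFin (λ i → if p i then f i else 0) + sumFin (λ i → if not (p i) then f i else 0)
sumFin-split p f = trans (sumFin-cong (λ i → split (p i) (f i)))
                         (sumFin-+ (λ i → if p i then f i else 0) (λ i → if not (p i) then f i else 0))
  where
  split : ∀ b x → x ≡ (if b then x else 0) + (if not b then x else 0)
  split true  x = sym (+-identityʳ x)
  split false x = refl

sumFin-if-remove : ∀ {n} (p : Fin (suc n) → Bool) (f : Fin (suc n) → ℕ) {u} → p u ≡ false →
                   sumFin (λ v → if p v then f v else 0)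
                   ≡ sumFin (λ i → if p (punchIn u i) then f (punchIn u i) else 0)
sumFin-if-remove p f {u} pu =
  trans (sumFin-remove (λ v → if p v then f v else 0) u) (cong (λ b → (if b then f u else 0) + rest) pu)
  where
  rest : ℕ
  rest = sumFin (λ i → if p (punchIn u i) then f (punchIn u i) else 0)

count : ∀ {n} → (Fin n → Bool) → ℕ
count p = sumFin (λ i → ind (p i))

count-true : ∀ n → count {n} (λ _ → true) ≡ n
count-true zero    = refl
count-true (suc n) = cong suc (count-true n)

count≡sum-if : ∀ {n} (p : Fin n → Bool) → count p ≡ sumFin (λ i → if p i then 1 else 0)
count≡sum-if p = sumFin-cong (λ i → ind-if (p i))
  where
  ind-if : ∀ b → ind b ≡ (if b then 1 else 0)
  ind-if true  = refl
  ind-if false = refl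

count-split : ∀ {n} (p q : Fin n → Bool) →
              count q ≡ count (λ i → p i ∧ q i) + count (λ i → not (p i) ∧ q i)
count-split p q = trans (sumFin-split p (ind ∘ q))
  (cong₂ _+_ (sumFin-cong (λ i → if-ind (p i) (q i))) (sumFin-cong (λ i → if-ind (not (p i)) (q i))))
  where
  if-ind : ∀ a b → (if a then ind b else 0) ≡ ind (a ∧ b)
  if-ind true  b = refl
  if-ind false b = refl

count-remove : ∀ {n} (p : Fin (suc n) → Bool) x → count p ≡ ind (p x) + count (p ∘ punchIn x)
count-remove p = sumFin-remove (ind ∘ p)

count-punch : ∀ {n} (p : Fin (suc n) → Bool) {x} → p x ≡ true → count p ≡ suc (count (p ∘ punchIn x))
count-punch p {x} px = trans (count-remove p x) (cong (λ b → ind b + count (p ∘ punchIn x)) px)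

count-witness : ∀ {n} (p : Fin n → Bool) → 1 ≤ count p → ∃ λ i → p i ≡ true
count-witness {zero}  p ()
count-witness {suc n} p 1≤ with p zero in p0
... | true  = zero , p0
... | false = let (i , pi) = count-witness (p ∘ suc) 1≤ in suc i , pi

count-other-witness : ∀ {n} (p : Fin (suc n) → Bool) → 2 ≤ count p →
                      ∀ x → ∃ λ w → p w ≡ true × w ≢ x
count-other-witness p 2≤ x =
  let (i , pi) = count-witness (p ∘ punchIn x) 1≤ in punchIn x i , pi , punchInᵢ≢i x i
  where
  ind≤1 : ∀ b → ind b ≤ 1
  ind≤1 true  = ≤-refl
  ind≤1 false = z≤n
  1≤ : 1 ≤ count (p ∘ punchIn x)
  1≤ = +-cancelˡ-≤ 1 1 _
         (≤-trans 2≤ (≤-trans (≤-reflexive (count-remove p x)) (+-monoˡ-≤ _ (ind≤1 (p x)))))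

count-≥1 : ∀ {n} (p : Fin n → Bool) {x} → p x ≡ true → 1 ≤ count p
count-≥1 {suc n} p px = subst (1 ≤_) (sym (count-punch p px)) (s≤s z≤n)

count-≥2 : ∀ {n} (p : Fin n → Bool) {x y} → p x ≡ true → p y ≡ true → x ≢ y → 2 ≤ count p
count-≥2 {suc n} p {x} px py x≢y =
  subst (2 ≤_) (sym (count-punch p px))
    (s≤s (count-≥1 (p ∘ punchIn x) (trans (cong p (punchIn-punchOut x≢y)) py)))

count-≥3 : ∀ {n} (p : Fin n → Bool) {x y z} → p x ≡ true → p y ≡ true → p z ≡ true →
           x ≢ y → x ≢ z → y ≢ z → 3 ≤ count p
count-≥3 {suc n} p {x} px py pz x≢y x≢z y≢z =
  subst (3 ≤_) (sym (count-punch p px))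
    (s≤s (count-≥2 (p ∘ punchIn x) (lift x≢y py) (lift x≢z pz) (y≢z ∘ punchOut-injective x≢y x≢z)))
  where
  lift : ∀ {w} (x≢w : x ≢ w) → p w ≡ true → p (punchIn x (punchOut x≢w)) ≡ true
  lift x≢w pw = trans (cong p (punchIn-punchOut x≢w)) pw

≢⇒==-false : ∀ {n} {i j : Fin n} → i ≢ j → (i == j) ≡ false
≢⇒==-false {i = i} {j} i≢j = trans (isYes≗does (i ≟ j)) (dec-false (i ≟ j) i≢j)

adj⇒≢ : ∀ {n} (G : Graph n) {x y} → adj G x y ≡ true → x ≢ y
adj⇒≢ G {x} xy refl = contradiction (trans (sym xy) (adj-irrefl G x)) λ ()

adj-separates : ∀ {n} (G : Graph n) {c p q} → adj G c p ≡ true → adj G c q ≡ false → p ≢ q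
adj-separates G cp cq refl = contradiction (trans (sym cp) cq) λ ()

adj-symmetrize : ∀ {n} (r : Fin n → Fin n → Bool) {x y} → x ≢ y →
                 adj (symmetrize r) x y ≡ r x y ∨ r y x
adj-symmetrize r {x} {y} x≢y = cong (λ b → not b ∧ (r x y ∨ r y x)) (≢⇒==-false x≢y)

adj-complement : ∀ {n} (G : Graph n) {x y} → x ≢ y → adj (complement G) x y ≡ not (adj G x y)
adj-complement G {x} {y} x≢y = begin
  adj (complement G) x y             ≡⟨ adj-symmetrize (λ i j → not (adj G i j)) x≢y ⟩
  not (adj G x y) ∨ not (adj G y x)  ≡⟨ cong (λ b → not (adj G x y) ∨ not b) (adj-sym G y x) ⟩
  not (adj G x y) ∨ not (adj G x y)  ≡⟨ ∨-idem _ ⟩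
  not (adj G x y)                    ∎
  where open ≡-Reasoning

symmetrize-adj : ∀ {n} (r : Fin n → Fin n → Bool) {x y} → x ≢ y → r x y ≡ true →
                 adj (symmetrize r) x y ≡ true
symmetrize-adj r {x} {y} x≢y rxy = trans (adj-symmetrize r x≢y) (cong (_∨ r y x) rxy)

contract-relation : ∀ {n} → Graph (suc n) → Fin (suc n) → Fin n → Fin n → Fin n → Bool
contract-relation H v u x y = adj H (punchIn v x) (punchIn v y) ∨ (x == u ∧ adj H v (punchIn v y))

contract-adj : ∀ {n} (H : Graph (suc n)) v u {p q} →
               adj H (punchIn v p) (punchIn v q) ≡ true → adj (contract H v u) p q ≡ true
contract-adj H v u {p} {q} e =
  symmetrize-adj (contract-relation H v u) (adj⇒≢ H e ∘ cong (punchIn v))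
    (cong (_∨ (p == u ∧ adj H v (punchIn v q))) e)

contract-merged-adj : ∀ {n} (H : Graph (suc n)) v u {q} → u ≢ q →
                      adj H v (punchIn v q) ≡ true → adj (contract H v u) u q ≡ true
contract-merged-adj H v u {q} u≢q e =
  symmetrize-adj (contract-relation H v u) u≢q
    (trans (cong₂ (λ a b → adj H (punchIn v u) (punchIn v q) ∨ (a ∧ b)) (==-refl u) e) (∨-zeroʳ _))

degree-universal : ∀ {n} (H : Graph (suc n)) c → (∀ k → c ≢ k → adj H c k ≡ true) → degree H c ≡ n
degree-universal {n} H c universal = begin
  degree H c                                     ≡⟨ count-remove (adj H c) c ⟩
  ind (adj H c c) + count (adj H c ∘ punchIn c)  ≡⟨ cong₂ _+_ (cong ind (adj-irrefl H c)) others ⟩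
  count {n} (λ _ → true)                         ≡⟨ count-true n ⟩
  n                                              ∎
  where
  open ≡-Reasoning
  others : count (adj H c ∘ punchIn c) ≡ count {n} (λ _ → true)
  others = sumFin-cong (λ i → cong ind (universal (punchIn c i) (punchInᵢ≢i c i ∘ sym)))

not-<ᵇ : ∀ {m n} → m ≢ n → not (m <ᵇ n) ≡ (n <ᵇ m)
not-<ᵇ {zero}  {zero}  0≢0 = contradiction refl 0≢0
not-<ᵇ {zero}  {suc n} _   = refl
not-<ᵇ {suc m} {zero}  _   = refl
not-<ᵇ {suc m} {suc n} m+1≢n+1 = not-<ᵇ (m+1≢n+1 ∘ cong suc)

edge-orientation : ∀ {n} (G : Graph n) i j →
                   not (toℕ i <ᵇ toℕ j) ∧ adj G i j ≡ (toℕ j <ᵇ toℕ i) ∧ adj G j i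
edge-orientation G i j rewrite adj-sym G j i with adj G i j in e
... | false = trans (∧-zeroʳ _) (sym (∧-zeroʳ _))
... | true  = trans (∧-identityʳ _) (trans (not-<ᵇ (adj⇒≢ G e ∘ toℕ-injective)) (sym (∧-identityʳ _)))

handshake : ∀ {n} (G : Graph n) → sumFin (degree G) ≡ edgeCount G + edgeCount G
handshake {n} G = begin
  sumFin (degree G)
    ≡⟨ sumFin-cong (λ i → count-split (λ j → lt i j) (adj G i)) ⟩
  sumFin (λ i → count (λ j → lt i j ∧ adj G i j) + count (λ j → not (lt i j) ∧ adj G i j))
    ≡⟨ sumFin-+ (λ i → count (λ j → lt i j ∧ adj G i j))
                (λ i → count (λ j → not (lt i j) ∧ adj G i j)) ⟩
  edgeCount G + sumFin (λ i → count (λ j → not (lt i j) ∧ adj G i j))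
    ≡⟨ cong (edgeCount G +_) (sumFin-cong (λ i → sumFin-cong (λ j → cong ind (edge-orientation G i j)))) ⟩
  edgeCount G + sumFin (λ i → sumFin (λ j → ind (lt j i ∧ adj G j i)))
    ≡⟨ cong (edgeCount G +_) (sumFin-comm (λ i j → ind (lt j i ∧ adj G j i))) ⟩
  edgeCount G + edgeCount G
    ∎
  where
  open ≡-Reasoning
  lt : Fin n → Fin n → Bool
  lt i j = toℕ i <ᵇ toℕ j

nonNeighbour : ∀ {n} → Graph n → Fin n → Fin n → Bool
nonNeighbour G u v = not (adj G u v) ∧ not (v == u)

nonNeighbour-intro : ∀ {n} (G : Graph n) {u v} → v ≢ u → adj G u v ≡ false → nonNeighbour G u v ≡ true
nonNeighbour-intro G v≢u uv = cong₂ (λ a b → not a ∧ not b) uv (≢⇒==-false v≢u)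

nonNeighbour-elim : ∀ {n} (G : Graph n) {u v} → nonNeighbour G u v ≡ true → v ≢ u × adj G u v ≡ false
nonNeighbour-elim G {u} {v} e = v≢u , not-injective (∧-conicalˡ _ _ e)
  where
  v≢u : v ≢ u
  v≢u refl = contradiction (trans (cong not (sym (==-refl v))) (∧-conicalʳ _ _ e)) λ ()

nonNeighbour-self : ∀ {n} (G : Graph n) u → nonNeighbour G u u ≡ false
nonNeighbour-self G u = trans (cong (λ b → not (adj G u u) ∧ not b) (==-refl u)) (∧-zeroʳ _)

nonNeighbour-punchIn : ∀ {n} (G : Graph (suc n)) u i →
                       nonNeighbour G u (punchIn u i) ≡ not (adj G u (punchIn u i))
nonNeighbour-punchIn G u i =
  trans (cong (λ b → not (adj G u (punchIn u i)) ∧ not b) (≢⇒==-false (punchInᵢ≢i u i)))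
        (∧-identityʳ _)

sumFin-around : ∀ {n} (G : Graph (suc n)) u (f : Fin (suc n) → ℕ) →
                sumFin f ≡ f u + (sumFin (λ v → if adj G u v then f v else 0)
                                  + sumFin (λ v → if nonNeighbour G u v then f v else 0))
sumFin-around {n} G u f = begin
  sumFin f
    ≡⟨ sumFin-remove f u ⟩
  f u + sumFin (f ∘ punchIn u)
    ≡⟨ cong (f u +_) (sumFin-split (adj G u ∘ punchIn u) (f ∘ punchIn u)) ⟩
  f u + (sumFin (λ i → if adj G u (punchIn u i) then f (punchIn u i) else 0)
         + sumFin (λ i → if not (adj G u (punchIn u i)) then f (punchIn u i) else 0))
    ≡⟨ cong (f u +_) (cong₂ _+_ neighbours nonNeighbours) ⟨
  f u + (sumFin (λ v → if adj G u v then f v else 0) + sumFin (λ v → if nonNeighbour G u v then f v else 0))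
    ∎
  where
  open ≡-Reasoning
  restricted : (Fin (suc n) → Bool) → ℕ
  restricted p = sumFin (λ v → if p v then f v else 0)
  neighbours : restricted (adj G u) ≡ sumFin (λ i → if adj G u (punchIn u i) then f (punchIn u i) else 0)
  neighbours = sumFin-if-remove (adj G u) f (adj-irrefl G u)
  nonNeighbours : restricted (nonNeighbour G u)
                  ≡ sumFin (λ i → if not (adj G u (punchIn u i)) then f (punchIn u i) else 0)
  nonNeighbours =
    trans (sumFin-if-remove (nonNeighbour G u) f (nonNeighbour-self G u))
          (sumFin-cong (λ i → cong (λ b → if b then f (punchIn u i) else 0) (nonNeighbour-punchIn G u i)))

degree+count-nonNeighbour : ∀ {n} (G : Graph (suc n)) u → degree G u + count (nonNeighbour G u) ≡ n
degree+count-nonNeighbour {n} G u = suc-injective (begin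
  suc (degree G u + count (nonNeighbour G u))
    ≡⟨ cong₂ (λ d a → suc (d + a)) (count≡sum-if (adj G u)) (count≡sum-if (nonNeighbour G u)) ⟩
  1 + (sumFin (λ v → if adj G u v then 1 else 0) + sumFin (λ v → if nonNeighbour G u v then 1 else 0))
    ≡⟨ sumFin-around G u (λ _ → 1) ⟨
  count {suc n} (λ _ → true)
    ≡⟨ count-true (suc n) ⟩
  suc n
    ∎)
  where open ≡-Reasoning

neighboursIn : ∀ {n} → Graph n → (Fin n → Bool) → Fin n → ℕ
neighboursIn G p v = count (λ w → adj G v w ∧ p w)

degreeSumOver : ∀ {n} → Graph n → (Fin n → Bool) → ℕ
degreeSumOver G p = sumFin (λ v → if p v then degree G v else 0)

degreeSumOver≡sum-neighboursIn : ∀ {n} (G : Graph n) p → degreeSumOver G p ≡ sumFin (neighboursIn G p)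
degreeSumOver≡sum-neighboursIn {n} G p = begin
  sumFin (λ v → if p v then degree G v else 0)
    ≡⟨ sumFin-cong (λ v → if-count (p v) (adj G v)) ⟩
  sumFin (λ v → count (λ w → p v ∧ adj G v w))
    ≡⟨ sumFin-comm (λ v w → ind (p v ∧ adj G v w)) ⟩
  sumFin (λ w → sumFin (λ v → ind (p v ∧ adj G v w)))
    ≡⟨ sumFin-cong (λ w → sumFin-cong (λ v → cong ind (flip v w))) ⟩
  sumFin (neighboursIn G p)
    ∎
  where
  open ≡-Reasoning
  if-count : ∀ b (q : Fin n → Bool) → (if b then count q else 0) ≡ count (λ w → b ∧ q w)
  if-count true  q = refl
  if-count false q = sym (sumFin-zero n)
  flip : ∀ v w → p v ∧ adj G v w ≡ adj G w v ∧ p v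
  flip v w = trans (∧-comm (p v) _) (cong (_∧ p v) (adj-sym G v w))

degreeSumOver-nonNeighbour≤ : ∀ {n} (G : Graph (suc n)) u {k} →
                              (∀ v → v ≢ u → neighboursIn G (nonNeighbour G u) v ≤ k) →
                              degreeSumOver G (nonNeighbour G u) ≤ sumFin {n} (λ _ → k)
degreeSumOver-nonNeighbour≤ {n} G u {k} bound = begin
  degreeSumOver G A
    ≡⟨ degreeSumOver≡sum-neighboursIn G A ⟩
  sumFin (neighboursIn G A)
    ≡⟨ sumFin-remove (neighboursIn G A) u ⟩
  neighboursIn G A u + sumFin (neighboursIn G A ∘ punchIn u)
    ≡⟨ cong (_+ sumFin (neighboursIn G A ∘ punchIn u)) u-has-none ⟩
  sumFin (neighboursIn G A ∘ punchIn u)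
    ≤⟨ sumFin-mono (λ i → bound (punchIn u i) (punchInᵢ≢i u i)) ⟩
  sumFin {n} (λ _ → k)
    ∎
  where
  open ≤-Reasoning
  A : Fin (suc n) → Bool
  A = nonNeighbour G u
  contradictory : ∀ a b → a ∧ (not a ∧ b) ≡ false
  contradictory true  b = refl
  contradictory false b = refl
  u-has-none : neighboursIn G A u ≡ 0
  u-has-none =
    trans (sumFin-cong (λ w → cong ind (contradictory (adj G u w) (not (w == u))))) (sumFin-zero (suc n))

Dominates : ∀ {n} → Graph n → Fin n → Fin n → Fin n → Fin n → Set
Dominates H x y z w =
  w ≡ x ⊎ w ≡ y ⊎ w ≡ z ⊎ adj H x w ≡ true ⊎ adj H y w ≡ true ⊎ adj H z w ≡ true

dominates? : ∀ {n} (H : Graph n) x y z → Decidable (Dominates H x y z)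
dominates? H x y z w =
  w ≟ x ⊎-dec w ≟ y ⊎-dec w ≟ z
    ⊎-dec adj H x w ≟ᵇ true ⊎-dec adj H y w ≟ᵇ true ⊎-dec adj H z w ≟ᵇ true

CommonNonNeighbour : ∀ {n} → Graph n → Fin n → Fin n → Fin n → Set
CommonNonNeighbour H x y z =
  ∃ λ w → w ≢ x × w ≢ y × w ≢ z × adj H x w ≡ false × adj H y w ≡ false × adj H z w ≡ false

CommonNeighbour : ∀ {n} → Graph n → Fin n → Fin n → Fin n → Set
CommonNeighbour G x y z =
  ∃ λ w → w ≢ x × w ≢ y × w ≢ z × adj G x w ≡ true × adj G y w ≡ true × adj G z w ≡ true

-- Contract y into x, then z into the merged vertex c; every other vertex was adjacent to one
-- of x, y, z, so c is adjacent to all n other vertices of the (n + 1)-vertex minor.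
dominating-path⇒minor : ∀ {n} (H : Graph (3 + n)) {x y z} →
                        x ≢ z → adj H x y ≡ true → adj H y z ≡ true →
                        (∀ w → Dominates H x y z w) → HasMinorWithMaxDegree≥ H n
dominating-path⇒minor {n} H {x} {y} {z} x≢z xy yz dominated =
  suc n , H₂ , H₂≼H , c , ≤-reflexive (sym (degree-universal H₂ c c-universal))
  where
  y≢x : y ≢ x
  y≢x = adj⇒≢ H xy ∘ sym
  y≢z : y ≢ z
  y≢z = adj⇒≢ H yz
  x′ z′ : Fin (2 + n)
  x′ = punchOut y≢x
  z′ = punchOut y≢z
  x′≡x : punchIn y x′ ≡ x
  x′≡x = punchIn-punchOut y≢x
  z′≡z : punchIn y z′ ≡ z
  z′≡z = punchIn-punchOut y≢z
  z′≢x′ : z′ ≢ x′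
  z′≢x′ e = x≢z (trans (sym x′≡x) (trans (cong (punchIn y) (sym e)) z′≡z))
  c : Fin (1 + n)
  c = punchOut z′≢x′
  c≡x′ : punchIn z′ c ≡ x′
  c≡x′ = punchIn-punchOut z′≢x′
  H₁ : Graph (2 + n)
  H₁ = contract H y x′
  H₂ : Graph (1 + n)
  H₂ = contract H₁ z′ c
  x′z′ : adj H₁ x′ z′ ≡ true
  x′z′ = contract-merged-adj H y x′ (z′≢x′ ∘ sym) (subst (λ t → adj H y t ≡ true) (sym z′≡z) yz)
  H₂≼H : H₂ ≼ H
  H₂≼H = ≼-contr y x′ (subst (λ t → adj H t y ≡ true) (sym x′≡x) xy)
           (≼-contr z′ c (subst (λ t → adj H₁ t z′ ≡ true) (sym c≡x′) x′z′) ≼-refl)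
  c-universal : ∀ k → c ≢ k → adj H₂ c k ≡ true
  c-universal k c≢k = via (dominated w)
    where
    q : Fin (2 + n)
    q = punchIn z′ k
    w : Fin (3 + n)
    w = punchIn y q
    x′≢q : x′ ≢ q
    x′≢q e = c≢k (punchIn-injective z′ c k (trans c≡x′ e))
    via-x′ : adj H₁ x′ q ≡ true → adj H₂ c k ≡ true
    via-x′ e = contract-adj H₁ z′ c (subst (λ t → adj H₁ t q ≡ true) (sym c≡x′) e)
    via : Dominates H x y z w → adj H₂ c k ≡ true
    via (inj₁ w≡x) = contradiction (sym (punchIn-injective y q x′ (trans w≡x (sym x′≡x)))) x′≢q
    via (inj₂ (inj₁ w≡y)) = contradiction w≡y (punchInᵢ≢i y q)
    via (inj₂ (inj₂ (inj₁ w≡z))) =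
      contradiction (punchIn-injective y q z′ (trans w≡z (sym z′≡z))) (punchInᵢ≢i z′ k)
    via (inj₂ (inj₂ (inj₂ (inj₁ xw)))) =
      via-x′ (contract-adj H y x′ (subst (λ t → adj H t w ≡ true) (sym x′≡x) xw))
    via (inj₂ (inj₂ (inj₂ (inj₂ (inj₁ yw))))) = via-x′ (contract-merged-adj H y x′ x′≢q yw)
    via (inj₂ (inj₂ (inj₂ (inj₂ (inj₂ zw))))) =
      contract-merged-adj H₁ z′ c c≢k (contract-adj H y x′ (subst (λ t → adj H t w ≡ true) (sym z′≡z) zw))

path⇒commonNonNeighbour : ∀ {n} (H : Graph (3 + n)) → ¬ HasMinorWithMaxDegree≥ H n →
                          ∀ {x y z} → x ≢ z → adj H x y ≡ true → adj H y z ≡ true →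
                          CommonNonNeighbour H x y z
path⇒commonNonNeighbour H noMinor {x} {y} {z} x≢z xy yz =
  let (w , undominated) = ¬∀⟶∃¬ _ (Dominates H x y z) (dominates? H x y z)
                                 (noMinor ∘ dominating-path⇒minor H x≢z xy yz)
  in w , undominated ∘ inj₁ , undominated ∘ inj₂ ∘ inj₁ , undominated ∘ inj₂ ∘ inj₂ ∘ inj₁
       , ¬-not (undominated ∘ inj₂ ∘ inj₂ ∘ inj₂ ∘ inj₁)
       , ¬-not (undominated ∘ inj₂ ∘ inj₂ ∘ inj₂ ∘ inj₂ ∘ inj₁)
       , ¬-not (undominated ∘ inj₂ ∘ inj₂ ∘ inj₂ ∘ inj₂ ∘ inj₂)

path⇒commonNeighbour : ∀ {n} (G : Graph (3 + n)) → ¬ HasMinorWithMaxDegree≥ (complement G) n →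
                       ∀ {x y z} → x ≢ y → y ≢ z → x ≢ z → adj G x y ≡ false → adj G y z ≡ false →
                       CommonNeighbour G x y z
path⇒commonNeighbour G noMinor x≢y y≢z x≢z xy yz =
  let (w , w≢x , w≢y , w≢z , xw , yw , zw) =
        path⇒commonNonNeighbour (complement G) noMinor x≢z (to-complement x≢y xy) (to-complement y≢z yz)
  in w , w≢x , w≢y , w≢z
       , from-complement (w≢x ∘ sym) xw , from-complement (w≢y ∘ sym) yw , from-complement (w≢z ∘ sym) zw
  where
  to-complement : ∀ {p q} → p ≢ q → adj G p q ≡ false → adj (complement G) p q ≡ true
  to-complement p≢q pq = trans (adj-complement G p≢q) (cong not pq)
  from-complement : ∀ {p q} → p ≢ q → adj (complement G) p q ≡ false → adj G p q ≡ true
  from-complement p≢q pq = not-injective (trans (sym (adj-complement G p≢q)) pq)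

NonNeighbourIn : ∀ {n} → Graph n → (Fin n → Bool) → Fin n → Fin n → Set
NonNeighbourIn G p v w = p w ≡ true × adj G v w ≡ false

neighboursIn+3≤count : ∀ {n} (G : Graph n) p {v x y z} → x ≢ y → x ≢ z → y ≢ z →
                       NonNeighbourIn G p v x → NonNeighbourIn G p v y → NonNeighbourIn G p v z →
                       neighboursIn G p v + 3 ≤ count p
neighboursIn+3≤count {n} G p {v} x≢y x≢z y≢z x-in y-in z-in = begin
  neighboursIn G p v + 3
    ≤⟨ +-monoʳ-≤ _ (count-≥3 q (in-q x-in) (in-q y-in) (in-q z-in) x≢y x≢z y≢z) ⟩
  neighboursIn G p v + count q
    ≡⟨ count-split (adj G v) p ⟨
  count p
    ∎
  where
  open ≤-Reasoning
  q : Fin n → Bool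
  q w = not (adj G v w) ∧ p w
  in-q : ∀ {w} → NonNeighbourIn G p v w → q w ≡ true
  in-q (pw , vw) = cong₂ (λ a b → not a ∧ b) vw pw

neighboursIn+3≤count-by-extension :
  ∀ {n} (G : Graph (suc n)) p {v x} → 2 ≤ count p → NonNeighbourIn G p v x →
  (∀ y → p y ≡ true → y ≢ x → ∃ λ z → NonNeighbourIn G p v z × z ≢ x × z ≢ y) →
  neighboursIn G p v + 3 ≤ count p
neighboursIn+3≤count-by-extension G p {x = x} 2≤ x-in extend =
  let (y , py , y≢x) = count-other-witness p 2≤ x
      (z₁ , z₁-in , z₁≢x , _) = extend y py y≢x
      (z₂ , z₂-in , z₂≢x , z₂≢z₁) = extend z₁ (proj₁ z₁-in) z₁≢x
  in neighboursIn+3≤count G p (z₁≢x ∘ sym) (z₂≢x ∘ sym) (z₂≢z₁ ∘ sym) x-in z₁-in z₂-in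

module _ {n} (G : Graph (3 + n)) (nc : NonCompliant3 G) (u : Fin (3 + n)) where

  private
    A : Fin (3 + n) → Bool
    A = nonNeighbour G u
    sym-adj : ∀ {x y b} → adj G x y ≡ b → adj G y x ≡ b
    sym-adj {x} {y} = trans (adj-sym G y x)

  -- a–u–y is a path of the complement; its common neighbour c makes u–c–a a path of G.
  nonNeighbour-extension : ∀ {a} → A a ≡ true → ∀ y → A y ≡ true → y ≢ a →
                           ∃ λ z → NonNeighbourIn G A a z × z ≢ a × z ≢ y
  nonNeighbour-extension {a} a-far y y-far y≢a =
    let (a≢u , ua) = nonNeighbour-elim G a-far
        (y≢u , uy) = nonNeighbour-elim G y-far
        (c , _ , _ , _ , ac , uc , yc) =
          path⇒commonNeighbour G (proj₂ nc) a≢u (y≢u ∘ sym) (y≢a ∘ sym) (sym-adj ua) uy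
        (z , z≢u , _ , z≢a , uz , cz , az) =
          path⇒commonNonNeighbour G (proj₁ nc) (a≢u ∘ sym) uc (sym-adj ac)
    in z , (nonNeighbour-intro G z≢u uz , az) , z≢a , adj-separates G (sym-adj yc) cz ∘ sym

  -- x–u–y is a path of the complement; its common neighbour c makes b–u–c a path of G.
  neighbour-extension : ∀ {b x} → adj G u b ≡ true → NonNeighbourIn G A b x →
                        ∀ y → A y ≡ true → y ≢ x →
                        ∃ λ z → NonNeighbourIn G A b z × z ≢ x × z ≢ y
  neighbour-extension {b} {x} ub (x-far , bx) y y-far y≢x =
    let (x≢u , ux) = nonNeighbour-elim G x-far
        (y≢u , uy) = nonNeighbour-elim G y-far
        (c , _ , _ , _ , xc , uc , yc) =
          path⇒commonNeighbour G (proj₂ nc) x≢u (y≢u ∘ sym) (y≢x ∘ sym) (sym-adj ux) uy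
        (z , _ , z≢u , _ , bz , uz , cz) =
          path⇒commonNonNeighbour G (proj₁ nc) (adj-separates G xc (sym-adj bx) ∘ sym) (sym-adj ub) uc
    in z , (nonNeighbour-intro G z≢u uz , bz)
         , adj-separates G (sym-adj xc) cz ∘ sym , adj-separates G (sym-adj yc) cz ∘ sym

  neighboursIn-nonNeighbour+3≤ : 2 ≤ degree G u → 2 ≤ count A →
                                 ∀ v → v ≢ u → neighboursIn G A v + 3 ≤ count A
  neighboursIn-nonNeighbour+3≤ 2≤deg 2≤far v v≢u with adj G u v in uv
  ... | false =
    neighboursIn+3≤count-by-extension G A 2≤far (v-far , adj-irrefl G v) (nonNeighbour-extension v-far)
    where
    v-far : A v ≡ true
    v-far = nonNeighbour-intro G v≢u uv
  ... | true  =
    let (b , ub , b≢v) = count-other-witness (adj G u) 2≤deg v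
        (x , _ , x≢u , _ , vx , ux , _) = path⇒commonNonNeighbour G (proj₁ nc) (b≢v ∘ sym) (sym-adj uv) ub
        x-in : NonNeighbourIn G A v x
        x-in = (nonNeighbour-intro G x≢u ux , vx)
    in neighboursIn+3≤count-by-extension G A {v} {x} 2≤far x-in (neighbour-extension uv x-in)

lemma12 : (G : Graph 14) → edgeCount G ≡ 45 → (u : Fin 14) → degree G u ≡ 7 →
          NonCompliant3 G → neighbourDegreeSum G u ≥ 44
lemma12 G edges u deg-u nc = +-cancelʳ-≤ (degreeSumOver G A) 44 _ (begin
  44 + degreeSumOver G A                      ≤⟨ +-monoʳ-≤ 44 A-degrees ⟩
  83                                          ≡⟨ +-cancelˡ-≡ 7 _ _ degree-sum ⟨
  neighbourDegreeSum G u + degreeSumOver G A  ∎)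
  where
  open ≤-Reasoning
  A : Fin 14 → Bool
  A = nonNeighbour G u
  |A|≡6 : count A ≡ 6
  |A|≡6 = +-cancelˡ-≡ 7 _ _ (trans (cong (_+ count A) (sym deg-u)) (degree+count-nonNeighbour G u))
  neighboursIn-A≤3 : ∀ v → v ≢ u → neighboursIn G A v ≤ 3
  neighboursIn-A≤3 v v≢u = +-cancelʳ-≤ 3 _ 3 (subst (neighboursIn G A v + 3 ≤_) |A|≡6
    (neighboursIn-nonNeighbour+3≤ G nc u (subst (2 ≤_) (sym deg-u) (s≤s (s≤s z≤n)))
                                         (subst (2 ≤_) (sym |A|≡6) (s≤s (s≤s z≤n))) v v≢u))
  A-degrees : degreeSumOver G A ≤ 39
  A-degrees = degreeSumOver-nonNeighbour≤ G u neighboursIn-A≤3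
  other-degrees : ℕ
  other-degrees = neighbourDegreeSum G u + degreeSumOver G A
  degree-sum : 7 + other-degrees ≡ 90
  degree-sum = begin-equality
    7 + other-degrees           ≡⟨ cong (_+ other-degrees) deg-u ⟨
    degree G u + other-degrees  ≡⟨ sumFin-around G u (degree G) ⟨
    sumFin (degree G)           ≡⟨ handshake G ⟩
    edgeCount G + edgeCount G   ≡⟨ cong₂ _+_ edges edges ⟩
    90                          ∎
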